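{- Let $m$ be a positive integer. For every integer $i$ with $0\le i\le \frac{m}{2}$, \[ \frac{2(2m-i)}{2(m+1)B(m,m-i)-(6m-2i+3)}>\frac{2(m+1)B(m,i)-(4m+2i+3)}{2(m+i)}, \] where for $0\le j\le m$, \[ B(m,j)=\frac{A(m,j)}{2(j+2)(4m+2j+5)(m+1)(m-j+1)}, \] \[ A(m,j)=30+96m^2+94m+37j+72m^2j+8m^2j^2-j^3+99mj+5j^2+13mj^2+16m^3j+32m^3. \] -}

module Defs where

open import Data.Nat using (ℕ)
open import Data.Integer using (+_)
open import Data.Rational using (ℚ; 0ℚ; _+_; _*_; _-_; _÷_; _/_; ≢-nonZero)
open import Data.Rational.Properties using (_≟_)
open import Relation.Nullary using (yes; no)

ℚ[_] : ℕ → ℚ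
ℚ[ n ] = (+ n) / 1

-- total division on ℚ, with the convention p ⊘ 0 = 0
-- (all denominators occurring in the statement are nonzero in the paper)
_⊘_ : ℚ → ℚ → ℚ
p ⊘ q with q ≟ 0ℚ
... | yes _ = 0ℚ
... | no q≢0 = _÷_ p q {{≢-nonZero q≢0}}

infixl 7 _⊘_

A : ℕ → ℕ → ℚ
A m' j' =
  ℚ[ 30 ] + ℚ[ 96 ] * m * m + ℚ[ 94 ] * m + ℚ[ 37 ] * j
  + ℚ[ 72 ] * m * m * j + ℚ[ 8 ] * m * m * j * j - j * j * j
  + ℚ[ 99 ] * m * j + ℚ[ 5 ] * j * j + ℚ[ 13 ] * m * j * j
  + ℚ[ 16 ] * m * m * m * j + ℚ[ 32 ] * m * m * m
  where
    m = ℚ[ m' ]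
    j = ℚ[ j' ]

B : ℕ → ℕ → ℚ
B m' j' =
  A m' j' ⊘ (ℚ[ 2 ] * (j + ℚ[ 2 ]) * (ℚ[ 4 ] * m + ℚ[ 2 ] * j + ℚ[ 5 ])
             * (m + ℚ[ 1 ]) * (m - j + ℚ[ 1 ]))
  where
    m = ℚ[ m' ]
    j = ℚ[ j' ]

-- With d = m − 2i ≥ 0, both sides of the inequality are rational functions of i and d. Clearing the
-- denominators Q(m, j) of B(m, j) and cross-multiplying turns the claim into a polynomial inequality
-- in i and d, and the difference of its two sides expands to 3200 m² plus a polynomial with
-- nonnegative coefficients. The same kind of expansion shows that every denominator is positive, so
-- cross-multiplication is legitimate.
module Submission where

open import Defs
open import Algebra.Bundles using (CommutativeRing)
open import Algebra.Bundles.Raw using (RawRing)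
open import Data.List using (List; []; _∷_)
open import Data.Nat using (ℕ; zero; suc; _≤_; _∸_; z<s)
import Data.Nat as ℕ
open import Data.Nat.Properties as ℕP using (m≤n⇒∃[o]m+o≡n; m+n∸m≡n)
open import Data.Nat.Coprimality as Coprime using (1-coprimeTo)
open import Data.Integer as ℤ using (+_)
import Data.Integer.Properties as ℤP
open import Data.Product using (_,_)
open import Data.Vec using (_∷_; [])
open import Data.Fin using (zero; suc)
open import Level using (0ℓ)
open import Relation.Nullary using (yes; no; contradiction)
open import Relation.Binary.PropositionalEquality
  using (_≡_; refl; sym; trans; cong; cong₂; subst; subst₂)

infix 8 _·i^_·d^_
data Monomial : Set where
  _·i^_·d^_ : (coefficient iDegree dDegree : ℕ) → Monomial

Poly : Set
Poly = List Monomial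

-- The expressions are written once over an arbitrary raw ring, so that their instance at ℚ agrees
-- definitionally with Defs and their instance at the polynomials of the ring solver can be handed
-- to it. (The operators of ℚ are opened only after this module, as their names would clash.)
module Expressions (ring : RawRing 0ℓ 0ℓ) (ι : ℕ → RawRing.Carrier ring) where
  open RawRing ring using (_+_; _*_; -_) renaming (Carrier to R)

  infixl 6 _-_
  _-_ : R → R → R
  x - y = x + - y

  infixr 8 _^_
  _^_ : R → ℕ → R
  x ^ zero = ι 1
  x ^ suc n = x ^ n * x

  ⟦_⟧ : Poly → R → R → R
  ⟦ [] ⟧ i d = ι 0
  ⟦ c ·i^ a ·d^ b ∷ p ⟧ i d = ι c * i ^ a * d ^ b + ⟦ p ⟧ i d

  Aᵉ : R → R → R
  Aᵉ m j =
    ι 30 + ι 96 * m * m + ι 94 * m + ι 37 * j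
    + ι 72 * m * m * j + ι 8 * m * m * j * j - j * j * j
    + ι 99 * m * j + ι 5 * j * j + ι 13 * m * j * j
    + ι 16 * m * m * m * j + ι 32 * m * m * m

  Qᵉ : R → R → R
  Qᵉ m j = ι 2 * (j + ι 2) * (ι 4 * m + ι 2 * j + ι 5) * (m + ι 1) * (m - j + ι 1)

  -- In terms of i and d = m − 2i. Writing the inequality as N₂ / D₂ < N₁ / D₁, E₁ = D₁ Qₖ and
  -- E₂ = N₂ Qᵢ, where Qₖ = Q(m, m − i) and Qᵢ = Q(m, i); cross = N₁ D₂ Qᵢ Qₖ.
  module _ (i d : R) where
    m m-i Qₖ Qᵢ E₁ E₂ cross : R
    m = i + i + d
    m-i = i + d
    Qₖ = Qᵉ m m-i
    Qᵢ = Qᵉ m i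
    E₁ = ι 2 * (m + ι 1) * Aᵉ m m-i - (ι 6 * m - ι 2 * i + ι 3) * Qₖ
    E₂ = ι 2 * (m + ι 1) * Aᵉ m i - (ι 4 * m + ι 2 * i + ι 3) * Qᵢ
    cross = ι 2 * (ι 2 * m - i) * (ι 2 * (m + i)) * (Qᵢ * Qₖ)

open import Data.Rational as ℚ
  using (ℚ; 0ℚ; _+_; _*_; _-_; _<_; _>_; mkℚ; NonNegative; +-*-rawRing)
import Data.Rational.Properties as ℚP
open import Data.Rational.Solver using (module +-*-Solver)
open +-*-Solver using (Polynomial; con; var; _:+_; _:*_; _:-_; :-_; prove; solve; _:=_)
open import Algebra.Properties.CommutativeSemigroup
  (CommutativeRing.*-commutativeSemigroup ℚP.+-*-commutativeRing) using (interchange)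
open import Relation.Binary.PropositionalEquality using (module ≡-Reasoning)

ℚ[]≡mkℚ : ∀ n → ℚ[ n ] ≡ mkℚ (+ n) 0 _
ℚ[]≡mkℚ n = ℚP.normalize-coprime (Coprime.sym (1-coprimeTo n))

ℚ[]-+ : ∀ a b → ℚ[ a ℕ.+ b ] ≡ ℚ[ a ] + ℚ[ b ]
ℚ[]-+ a b rewrite ℚ[]≡mkℚ a | ℚ[]≡mkℚ b =
  cong (ℚ._/ 1) (cong₂ ℤ._+_ (sym (ℤP.*-identityʳ (+ a))) (sym (ℤP.*-identityʳ (+ b))))

ℚ[]-nonNeg : ∀ n → NonNegative ℚ[ n ]
ℚ[]-nonNeg n = ℚP.normalize-nonNeg n 1

ℚ[]-pos : ∀ {n} → 0 ℕ.< n → 0ℚ < ℚ[ n ]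
ℚ[]-pos {suc n} _ rewrite ℚ[]≡mkℚ (suc n) = ℚP.positive⁻¹ _

*-pos : ∀ {p q} → 0ℚ < p → 0ℚ < q → 0ℚ < p * q
*-pos {p} {q} p>0 q>0 =
  ℚP.positive⁻¹ _ {{ℚP.pos*pos⇒pos p {{ℚ.positive p>0}} q {{ℚ.positive q>0}}}}

*-cancelʳ-<-pos : ∀ {p q r} → 0ℚ < r → p * r < q * r → p < q
*-cancelʳ-<-pos {r = r} r>0 = ℚP.*-cancelʳ-<-nonNeg r {{ℚ.nonNegative (ℚP.<⇒≤ r>0)}}

pos-factor : ∀ {p q} → 0ℚ < q → 0ℚ < p * q → 0ℚ < p
pos-factor {p} {q} q>0 pq>0 = *-cancelʳ-<-pos q>0 (subst (_< p * q) (sym (ℚP.*-zeroˡ q)) pq>0)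

p<p+q : ∀ {p q} → 0ℚ < q → p < p + q
p<p+q {p} {q} q>0 = subst (_< p + q) (ℚP.+-identityʳ p) (ℚP.+-monoʳ-< p q>0)

p⊘q*q≡p : ∀ p {q} → 0ℚ < q → p ⊘ q * q ≡ p
p⊘q*q≡p p {q} q>0 with q ℚP.≟ 0ℚ
... | yes refl = contradiction q>0 (ℚP.<-irrefl refl)
... | no q≢0 = begin
  p * ℚ.1/ q * q    ≡⟨ ℚP.*-assoc p _ q ⟩
  p * (ℚ.1/ q * q)  ≡⟨ cong (p *_) (ℚP.*-inverseˡ q) ⟩
  p * ℚ.1ℚ          ≡⟨ ℚP.*-identityʳ p ⟩
  p                 ∎
  where
  open ≡-Reasoning
  instance _ = ℚ.≢-nonZero q≢0

[s*[a⊘q]-c]*q≡s*a-c*q : ∀ s a c {q} → 0ℚ < q → (s * (a ⊘ q) - c) * q ≡ s * a - c * q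
[s*[a⊘q]-c]*q≡s*a-c*q s a c {q} q>0 = trans
  (solve 4 (λ s u c q → (s :* u :- c) :* q := s :* (u :* q) :- c :* q) refl s (a ⊘ q) c q)
  (cong (λ u → s * u - c * q) (p⊘q*q≡p a q>0))

⊘-<-⊘ : ∀ {a b c d} → 0ℚ < b → 0ℚ < d → c * b < a * d → c ⊘ d < a ⊘ b
⊘-<-⊘ {a} {b} {c} {d} b>0 d>0 cb<ad = *-cancelʳ-<-pos (*-pos d>0 b>0) (begin-strict
  c ⊘ d * (d * b)  ≡⟨ sym (ℚP.*-assoc (c ⊘ d) d b) ⟩
  c ⊘ d * d * b    ≡⟨ cong (_* b) (p⊘q*q≡p c d>0) ⟩
  c * b            <⟨ cb<ad ⟩
  a * d            ≡⟨ cong (_* d) (sym (p⊘q*q≡p a b>0)) ⟩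
  a ⊘ b * b * d    ≡⟨ ℚP.*-assoc (a ⊘ b) b d ⟩
  a ⊘ b * (b * d)  ≡⟨ cong (a ⊘ b *_) (ℚP.*-comm b d) ⟩
  a ⊘ b * (d * b)  ∎)
  where open ℚP.≤-Reasoning

open Expressions +-*-rawRing ℚ[_] hiding (_-_)

^-nonNeg : ∀ p n .{{_ : NonNegative p}} → NonNegative (p ^ n)
^-nonNeg p zero = _
^-nonNeg p (suc n) = ℚP.nonNeg*nonNeg⇒nonNeg (p ^ n) {{^-nonNeg p n}} p

⟦⟧-nonNeg : ∀ P i d .{{_ : NonNegative i}} .{{_ : NonNegative d}} → NonNegative (⟦ P ⟧ i d)
⟦⟧-nonNeg [] i d = _
⟦⟧-nonNeg (c ·i^ a ·d^ b ∷ P) i d =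
  ℚP.nonNeg+nonNeg⇒nonNeg (ℚ[ c ] * i ^ a * d ^ b) {{monomial-nonNeg}} (⟦ P ⟧ i d) {{⟦⟧-nonNeg P i d}}
  where
  ciᵃ-nonNeg : NonNegative (ℚ[ c ] * i ^ a)
  ciᵃ-nonNeg = ℚP.nonNeg*nonNeg⇒nonNeg ℚ[ c ] {{ℚ[]-nonNeg c}} (i ^ a) {{^-nonNeg i a}}
  monomial-nonNeg : NonNegative (ℚ[ c ] * i ^ a * d ^ b)
  monomial-nonNeg = ℚP.nonNeg*nonNeg⇒nonNeg (ℚ[ c ] * i ^ a) {{ciᵃ-nonNeg}} (d ^ b) {{^-nonNeg d b}}

pos+⟦⟧ : ∀ {p} P i d .{{_ : NonNegative i}} .{{_ : NonNegative d}} → 0ℚ < p → 0ℚ < p + ⟦ P ⟧ i d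
pos+⟦⟧ P i d p>0 = ℚP.+-mono-<-≤ p>0 (ℚP.nonNegative⁻¹ _ {{⟦⟧-nonNeg P i d}})

polynomial-rawRing : RawRing 0ℓ 0ℓ
polynomial-rawRing = record
  { Carrier = Polynomial 2
  ; _≈_ = _≡_
  ; _+_ = _:+_
  ; _*_ = _:*_
  ; -_ = :-_
  ; 0# = con 0ℚ
  ; 1# = con ℚ.1ℚ
  }

module Syntax = Expressions polynomial-rawRing (λ c → con ℚ[ c ])

i̇ ḋ : Polynomial 2
i̇ = var zero
ḋ = var (suc zero)

Qₖ-rest : Poly
Qₖ-rest =
  110 ·i^ 1 ·d^ 0 ∷ 54 ·i^ 0 ·d^ 1 ∷ 210 ·i^ 2 ·d^ 0 ∷ 204 ·i^ 1 ·d^ 1 ∷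
  46 ·i^ 0 ·d^ 2 ∷ 160 ·i^ 3 ·d^ 0 ∷ 234 ·i^ 2 ·d^ 1 ∷ 102 ·i^ 1 ·d^ 2 ∷
  12 ·i^ 0 ·d^ 3 ∷ 40 ·i^ 4 ·d^ 0 ∷ 84 ·i^ 3 ·d^ 1 ∷ 56 ·i^ 2 ·d^ 2 ∷
  12 ·i^ 1 ·d^ 3 ∷ []

Qᵢ-rest : Poly
Qᵢ-rest =
  110 ·i^ 1 ·d^ 0 ∷ 56 ·i^ 0 ·d^ 1 ∷ 210 ·i^ 2 ·d^ 0 ∷ 216 ·i^ 1 ·d^ 1 ∷
  52 ·i^ 0 ·d^ 2 ∷ 160 ·i^ 3 ·d^ 0 ∷ 246 ·i^ 2 ·d^ 1 ∷ 114 ·i^ 1 ·d^ 2 ∷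
  16 ·i^ 0 ·d^ 3 ∷ 40 ·i^ 4 ·d^ 0 ∷ 76 ·i^ 3 ·d^ 1 ∷ 44 ·i^ 2 ·d^ 2 ∷
  8 ·i^ 1 ·d^ 3 ∷ []

E₁-rest : Poly
E₁-rest =
  20 ·i^ 0 ·d^ 1 ∷ 344 ·i^ 2 ·d^ 0 ∷ 544 ·i^ 1 ·d^ 1 ∷ 200 ·i^ 0 ·d^ 2 ∷
  906 ·i^ 3 ·d^ 0 ∷ 1980 ·i^ 2 ·d^ 1 ∷ 1394 ·i^ 1 ·d^ 2 ∷ 320 ·i^ 0 ·d^ 3 ∷
  876 ·i^ 4 ·d^ 0 ∷ 2506 ·i^ 3 ·d^ 1 ∷ 2640 ·i^ 2 ·d^ 2 ∷ 1218 ·i^ 1 ·d^ 3 ∷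
  208 ·i^ 0 ·d^ 4 ∷ 240 ·i^ 5 ·d^ 0 ∷ 904 ·i^ 4 ·d^ 1 ∷ 1336 ·i^ 3 ·d^ 2 ∷
  968 ·i^ 2 ·d^ 3 ∷ 344 ·i^ 1 ·d^ 4 ∷ 48 ·i^ 0 ·d^ 5 ∷ []

cross-rest : Poly
cross-rest =
  130880 ·i^ 3 ·d^ 0 ∷ 196320 ·i^ 2 ·d^ 1 ∷ 100640 ·i^ 1 ·d^ 2 ∷ 17600 ·i^ 0 ·d^ 3 ∷
  547184 ·i^ 4 ·d^ 0 ∷ 1094368 ·i^ 3 ·d^ 1 ∷ 842928 ·i^ 2 ·d^ 2 ∷ 295744 ·i^ 1 ·d^ 3 ∷
  39872 ·i^ 0 ·d^ 4 ∷ 1200192 ·i^ 5 ·d^ 0 ∷ 3000480 ·i^ 4 ·d^ 1 ∷ 3075712 ·i^ 3 ·d^ 2 ∷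
  1613088 ·i^ 2 ·d^ 3 ∷ 432768 ·i^ 1 ·d^ 4 ∷ 47552 ·i^ 0 ·d^ 5 ∷ 1469676 ·i^ 6 ·d^ 0 ∷
  4409028 ·i^ 5 ·d^ 1 ∷ 5627348 ·i^ 4 ·d^ 2 ∷ 3906316 ·i^ 3 ·d^ 3 ∷ 1556752 ·i^ 2 ·d^ 4 ∷
  338432 ·i^ 1 ·d^ 5 ∷ 31424 ·i^ 0 ·d^ 6 ∷ 983568 ·i^ 7 ·d^ 0 ∷ 3442488 ·i^ 6 ·d^ 1 ∷
  5230600 ·i^ 5 ·d^ 2 ∷ 4470280 ·i^ 4 ·d^ 3 ∷ 2327624 ·i^ 3 ·d^ 4 ∷ 742400 ·i^ 2 ·d^ 5 ∷
  135136 ·i^ 1 ·d^ 6 ∷ 10880 ·i^ 0 ·d^ 7 ∷ 324144 ·i^ 8 ·d^ 0 ∷ 1296576 ·i^ 7 ·d^ 1 ∷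
  2255148 ·i^ 6 ·d^ 2 ∷ 2227428 ·i^ 5 ·d^ 3 ∷ 1374004 ·i^ 4 ·d^ 4 ∷ 548300 ·i^ 3 ·d^ 5 ∷
  140576 ·i^ 2 ·d^ 6 ∷ 21568 ·i^ 1 ·d^ 7 ∷ 1536 ·i^ 0 ·d^ 8 ∷ 40320 ·i^ 9 ·d^ 0 ∷
  181440 ·i^ 8 ·d^ 1 ∷ 342624 ·i^ 7 ·d^ 2 ∷ 352464 ·i^ 6 ·d^ 3 ∷ 213744 ·i^ 5 ·d^ 4 ∷
  76560 ·i^ 4 ·d^ 5 ∷ 15024 ·i^ 3 ·d^ 6 ∷ 1248 ·i^ 2 ·d^ 7 ∷ []

Qₖ-expansion : ∀ i d → Qₖ i d ≡ ℚ[ 20 ] + ⟦ Qₖ-rest ⟧ i d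
Qₖ-expansion i d = prove (i ∷ d ∷ []) (Syntax.Qₖ i̇ ḋ) (con ℚ[ 20 ] :+ Syntax.⟦ Qₖ-rest ⟧ i̇ ḋ) refl

Qᵢ-expansion : ∀ i d → Qᵢ i d ≡ ℚ[ 20 ] + ⟦ Qᵢ-rest ⟧ i d
Qᵢ-expansion i d = prove (i ∷ d ∷ []) (Syntax.Qᵢ i̇ ḋ) (con ℚ[ 20 ] :+ Syntax.⟦ Qᵢ-rest ⟧ i̇ ḋ) refl

E₁-expansion : ∀ i d → E₁ i d ≡ ℚ[ 20 ] * m i d + ⟦ E₁-rest ⟧ i d
E₁-expansion i d =
  prove (i ∷ d ∷ []) (Syntax.E₁ i̇ ḋ) (con ℚ[ 20 ] :* Syntax.m i̇ ḋ :+ Syntax.⟦ E₁-rest ⟧ i̇ ḋ) refl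

cross-expansion : ∀ i d →
  cross i d ≡ E₂ i d * E₁ i d + (ℚ[ 3200 ] * (m i d * m i d) + ⟦ cross-rest ⟧ i d)
cross-expansion i d = prove (i ∷ d ∷ []) (Syntax.cross i̇ ḋ)
  (Syntax.E₂ i̇ ḋ :* Syntax.E₁ i̇ ḋ
    :+ (con ℚ[ 3200 ] :* (Syntax.m i̇ ḋ :* Syntax.m i̇ ḋ) :+ Syntax.⟦ cross-rest ⟧ i̇ ḋ))
  refl

Bℚ : ℚ → ℚ → ℚ
Bℚ M J = Aᵉ M J ⊘ Qᵉ M J

-- The statement of lemma3p4 unfolds to Inequality ℚ[ m ] ℚ[ m ∸ i ] ℚ[ i ].
Inequality : ℚ → ℚ → ℚ → Set
Inequality M K I =
  (ℚ[ 2 ] * (ℚ[ 2 ] * M - I)) ⊘ (ℚ[ 2 ] * (M + ℚ[ 1 ]) * Bℚ M K - (ℚ[ 6 ] * M - ℚ[ 2 ] * I + ℚ[ 3 ]))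
  >
  (ℚ[ 2 ] * (M + ℚ[ 1 ]) * Bℚ M I - (ℚ[ 4 ] * M + ℚ[ 2 ] * I + ℚ[ 3 ])) ⊘ (ℚ[ 2 ] * (M + I))

inequality : ∀ i d .{{_ : NonNegative i}} .{{_ : NonNegative d}} → 0ℚ < m i d →
  Inequality (m i d) (m-i i d) i
inequality i d m>0 = ⊘-<-⊘ D₁>0 D₂>0 N₂D₁<N₁D₂
  where
  M s cₖ cᵢ N₁ D₁ N₂ D₂ : ℚ
  M = m i d
  s = ℚ[ 2 ] * (M + ℚ[ 1 ])
  cₖ = ℚ[ 6 ] * M - ℚ[ 2 ] * i + ℚ[ 3 ]
  cᵢ = ℚ[ 4 ] * M + ℚ[ 2 ] * i + ℚ[ 3 ]
  N₁ = ℚ[ 2 ] * (ℚ[ 2 ] * M - i)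
  D₁ = s * Bℚ M (m-i i d) - cₖ
  N₂ = s * Bℚ M i - cᵢ
  D₂ = ℚ[ 2 ] * (M + i)

  Qₖ>0 : 0ℚ < Qₖ i d
  Qₖ>0 = subst (0ℚ <_) (sym (Qₖ-expansion i d)) (pos+⟦⟧ Qₖ-rest i d (ℚ[]-pos {20} z<s))

  Qᵢ>0 : 0ℚ < Qᵢ i d
  Qᵢ>0 = subst (0ℚ <_) (sym (Qᵢ-expansion i d)) (pos+⟦⟧ Qᵢ-rest i d (ℚ[]-pos {20} z<s))

  D₁Qₖ≡E₁ : D₁ * Qₖ i d ≡ E₁ i d
  D₁Qₖ≡E₁ = [s*[a⊘q]-c]*q≡s*a-c*q s (Aᵉ M (m-i i d)) cₖ Qₖ>0

  N₂Qᵢ≡E₂ : N₂ * Qᵢ i d ≡ E₂ i d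
  N₂Qᵢ≡E₂ = [s*[a⊘q]-c]*q≡s*a-c*q s (Aᵉ M i) cᵢ Qᵢ>0

  E₁>0 : 0ℚ < E₁ i d
  E₁>0 = subst (0ℚ <_) (sym (E₁-expansion i d))
    (pos+⟦⟧ E₁-rest i d (*-pos (ℚ[]-pos {20} z<s) m>0))

  D₁>0 : 0ℚ < D₁
  D₁>0 = pos-factor Qₖ>0 (subst (0ℚ <_) (sym D₁Qₖ≡E₁) E₁>0)

  D₂>0 : 0ℚ < D₂
  D₂>0 = *-pos (ℚ[]-pos {2} z<s) (ℚP.+-mono-<-≤ m>0 (ℚP.nonNegative⁻¹ i))

  gap>0 : 0ℚ < ℚ[ 3200 ] * (M * M) + ⟦ cross-rest ⟧ i d
  gap>0 = pos+⟦⟧ cross-rest i d (*-pos (ℚ[]-pos {3200} z<s) (*-pos m>0 m>0))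

  N₂D₁<N₁D₂ : N₂ * D₁ < N₁ * D₂
  N₂D₁<N₁D₂ = *-cancelʳ-<-pos (*-pos Qᵢ>0 Qₖ>0) (begin-strict
    N₂ * D₁ * (Qᵢ i d * Qₖ i d)  ≡⟨ interchange N₂ D₁ (Qᵢ i d) (Qₖ i d) ⟩
    N₂ * Qᵢ i d * (D₁ * Qₖ i d)  ≡⟨ cong₂ _*_ N₂Qᵢ≡E₂ D₁Qₖ≡E₁ ⟩
    E₂ i d * E₁ i d              <⟨ p<p+q gap>0 ⟩
    E₂ i d * E₁ i d + (ℚ[ 3200 ] * (M * M) + ⟦ cross-rest ⟧ i d)
                                 ≡⟨ sym (cross-expansion i d) ⟩
    N₁ * D₂ * (Qᵢ i d * Qₖ i d)  ∎)
    where open ℚP.≤-Reasoning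

inequality-ℕ : ∀ i d → 1 ≤ i ℕ.+ i ℕ.+ d →
  Inequality ℚ[ i ℕ.+ i ℕ.+ d ] ℚ[ i ℕ.+ i ℕ.+ d ∸ i ] ℚ[ i ]
inequality-ℕ i d 1≤m = subst₂ (λ M K → Inequality M K ℚ[ i ]) (sym m≡) (sym m-i≡)
  (inequality ℚ[ i ] ℚ[ d ] {{ℚ[]-nonNeg i}} {{ℚ[]-nonNeg d}} (subst (0ℚ <_) m≡ (ℚ[]-pos 1≤m)))
  where
  m≡ : ℚ[ i ℕ.+ i ℕ.+ d ] ≡ m ℚ[ i ] ℚ[ d ]
  m≡ = trans (ℚ[]-+ (i ℕ.+ i) d) (cong (_+ ℚ[ d ]) (ℚ[]-+ i i))
  m-i≡ : ℚ[ i ℕ.+ i ℕ.+ d ∸ i ] ≡ m-i ℚ[ i ] ℚ[ d ]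
  m-i≡ = trans (cong (λ n → ℚ[ n ∸ i ]) (ℕP.+-assoc i i d))
    (trans (cong ℚ[_] (m+n∸m≡n i (i ℕ.+ d))) (ℚ[]-+ i d))

lemma3p4 : (m i : ℕ) → 1 ≤ m → 2 Data.Nat.* i ≤ m →
    (ℚ[ 2 ] * (ℚ[ 2 ] * ℚ[ m ] - ℚ[ i ]))
      ⊘ (ℚ[ 2 ] * (ℚ[ m ] + ℚ[ 1 ]) * B m (m ∸ i) - (ℚ[ 6 ] * ℚ[ m ] - ℚ[ 2 ] * ℚ[ i ] + ℚ[ 3 ]))
    >
    (ℚ[ 2 ] * (ℚ[ m ] + ℚ[ 1 ]) * B m i - (ℚ[ 4 ] * ℚ[ m ] + ℚ[ 2 ] * ℚ[ i ] + ℚ[ 3 ]))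
      ⊘ (ℚ[ 2 ] * (ℚ[ m ] + ℚ[ i ]))
lemma3p4 n i 1≤n 2i≤n =
  let d , i+i+d≡n = m≤n⇒∃[o]m+o≡n (subst (_≤ n) (cong (i ℕ.+_) (ℕP.+-identityʳ i)) 2i≤n)
  in subst (λ n → Inequality ℚ[ n ] ℚ[ n ∸ i ] ℚ[ i ]) i+i+d≡n
       (inequality-ℕ i d (subst (1 ≤_) (sym i+i+d≡n) 1≤n))
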